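{- The minimum size of a self-identifying code of $K_3\times P_n$ is \[ \gamma^{\mathrm{SID}}(K_3\times P_n)=\begin{cases}9,& n=3,\\ 12,& n=4\text{ or }5,\\ 14,& n=6.\end{cases} \]
   Context: For a vertex $v$, $N[v]$ is its closed neighborhood. A nonempty set $S\subseteq V(G)$ is a self-identifying code of $G$ if for every vertex $v\in V(G)$: (1) $N[v]\cap S\neq\emptyset$, and (2) $\bigcap_{c\in N[v]\cap S}N[c]=\{v\}$; $\gamma^{\mathrm{SID}}(G)$ is the minimum size of such a code. With $V(K_m)=\{v_0,\dots,v_{m-1}\}$ and $V(P_n)=\{0,\dots,n-1\}$ (consecutively numbered path), the direct product $K_m\times P_n$ has vertices $(v_i,j)$, with $(v_i,j)$ adjacent to $(v_{i'},j')$ iff $i\neq i'$ and $|j-j'|=1$. -}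

module Defs where

open import Data.Nat using (ℕ; zero; suc; _*_; _≤_; _+_)
open import Data.Fin using (Fin; toℕ; remQuot)
open import Data.Fin.Subset using (Subset; _∈_; ∣_∣; Nonempty)
open import Data.Product using (_×_; proj₁; proj₂; ∃)
open import Relation.Binary.PropositionalEquality using (_≡_; _≢_)
open import Data.Sum using (_⊎_)

record Graph (N : ℕ) : Set₁ where
  field
    Adj : Fin N → Fin N → Set

open Graph public

InN : ∀ {N} → Graph N → Fin N → Fin N → Set
InN G v u = u ≡ v ⊎ Adj G v u

IsSIDCode : ∀ {N} → Graph N → Subset N → Set
IsSIDCode {N} G S =
  Nonempty S ×
  ((v : Fin N) →
     ∃ (λ c → InN G v c × c ∈ S) ×
     ((u : Fin N) → ((c : Fin N) → InN G v c → c ∈ S → InN G c u) → u ≡ v))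

IsSIDNumber : ∀ {N} → Graph N → ℕ → Set
IsSIDNumber {N} G k =
  (∃ λ S → IsSIDCode G S × ∣ S ∣ ≡ k) ×
  ((S : Subset N) → IsSIDCode G S → k ≤ ∣ S ∣)

AdjPath : ℕ → ℕ → Set
AdjPath a b = suc a ≡ b ⊎ suc b ≡ a

-- Direct product K_m × P_n; vertex (v_i , j) is encoded as combine i j : Fin (m * n)
-- (decoded by remQuot). (v_i,j) ~ (v_i',j') iff i ≠ i' and |j - j'| = 1.
KxP : (m n : ℕ) → Graph (m * n)
KxP m n = record { Adj = λ x y →
  proj₁ (remQuot {m} n x) ≢ proj₁ (remQuot {m} n y) ×
  AdjPath (toℕ (proj₂ (remQuot {m} n x))) (toℕ (proj₂ (remQuot {m} n y))) }

-- If u ≠ v, a self-identifying code S contains some c ∈ N[v] with u ∉ N[c]: otherwise u lies in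
-- every N[c] with c ∈ N[v] ∩ S, contradicting condition (2) at v. So every set N[v] ∖ N[u] meets S,
-- and k pairwise disjoint sets of this form force |S| ≥ k. In K₃ × Pₙ this forces the two end
-- columns of the path and their neighbouring columns into every code; for n = 6 two further
-- disjoint three-element sets in the middle force two more vertices. Codes of matching size are
-- checked by computation.
module Submission where

open import Data.Empty using (⊥-elim)
open import Data.Fin using (Fin; toℕ; remQuot; combine; _≟_; #_)
open import Data.Fin.Properties using (any?; all?)
open import Data.Fin.Subset using (Subset; _∈_; ∣_∣; ⊤; _-_)
open import Data.Fin.Subset.Properties using (_∈?_; x∈p⇒∣p-x∣<∣p∣; x∈p∧x≢y⇒x∈p-y)
open import Data.List using (List; []; _∷_; _++_; map; filter; length; allFin)
open import Data.List.Membership.Propositional using (find; lose)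
open import Data.List.Membership.Propositional.Properties using (∈-filter⁺; ∈-allFin)
open import Data.List.Properties using (length-map)
open import Data.List.Relation.Binary.Disjoint.Propositional using (Disjoint)
open import Data.List.Relation.Unary.All as All using (All; []; _∷_)
open import Data.List.Relation.Unary.All.Properties using (map⁺)
open import Data.List.Relation.Unary.AllPairs using (AllPairs; []; _∷_; allPairs?)
open import Data.List.Relation.Unary.Any as Any using (Any)
open import Data.Nat using (ℕ; suc; _*_; _≤_; z≤n)
import Data.Nat as ℕ
open import Data.Nat.Properties using (<-≤-trans)
open import Data.Product using (_×_; _,_; proj₁; proj₂; uncurry)
open import Defs
open import Relation.Binary.Definitions using (Decidable)
open import Relation.Binary.PropositionalEquality using (_≡_; _≢_; refl; sym; subst)
open import Relation.Nullary using (yes; no; ¬?)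
open import Relation.Nullary.Decidable using (True; toWitness; _×-dec_; _⊎-dec_; _→-dec_)
import Relation.Unary as U

disjoint-hitting-≤ : ∀ {n} {S : Subset n} {xss : List (List (Fin n))} →
                     AllPairs Disjoint xss → All (Any (_∈ S)) xss → length xss ≤ ∣ S ∣
disjoint-hitting-≤ [] [] = z≤n
disjoint-hitting-≤ {S = S} {xs ∷ xss} (xs♯xss ∷ disjoint) (hit ∷ hits)
  with x , x∈xs , x∈S ← find hit
  = <-≤-trans (ℕ.s≤s (disjoint-hitting-≤ disjoint (All.zipWith avoid (xs♯xss , hits))))
              (x∈p⇒∣p-x∣<∣p∣ x∈S)
  where
  avoid : ∀ {ys} → Disjoint xs ys × Any (_∈ S) ys → Any (_∈ S - x) ys
  avoid (xs♯ys , hitᵧ) with y , y∈ys , y∈S ← find hitᵧ =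
    lose y∈ys (x∈p∧x≢y⇒x∈p-y y∈S λ { refl → xs♯ys (x∈xs , y∈ys) })

module DecidableGraph {N : ℕ} (G : Graph N) (adj? : Decidable (Adj G)) where
  open import Data.List.Relation.Binary.Disjoint.DecPropositional (_≟_ {N}) using (disjoint?)

  inN? : Decidable (InN G)
  inN? v u = (u ≟ v) ⊎-dec adj? v u

  isSIDCode? : U.Decidable (IsSIDCode G)
  isSIDCode? S = any? (_∈? S) ×-dec all? λ v →
    any? (λ c → inN? v c ×-dec c ∈? S) ×-dec
    all? (λ u → all? (λ c → inN? v c →-dec c ∈? S →-dec inN? c u) →-dec u ≟ v)

  -- N[v] ∖ N[u], written as u ∉ N[c] so that symmetry of Adj is not needed
  separators : Fin N → Fin N → List (Fin N)
  separators v u = filter (λ c → inN? v c ×-dec ¬? (inN? c u)) (allFin N)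

  separators-meet-code : ∀ {S} → IsSIDCode G S → ∀ {v u} → u ≢ v → Any (_∈ S) (separators v u)
  separators-meet-code {S} (_ , identifies) {v} {u} u≢v
    with Any.any? (_∈? S) (separators v u)
  ... | yes hit = hit
  ... | no miss = ⊥-elim (u≢v (proj₂ (identifies v) u covers))
    where
    covers : ∀ c → InN G v c → c ∈ S → InN G c u
    covers c v∼c c∈S with inN? c u
    ... | yes c∼u = c∼u
    ... | no c≁u = ⊥-elim (miss (lose (∈-filter⁺ _ (∈-allFin c) (v∼c , c≁u)) c∈S))

  SeparatingPairs : List (Fin N × Fin N) → Set
  SeparatingPairs ps =
    All (λ (v , u) → u ≢ v) ps × AllPairs Disjoint (map (uncurry separators) ps)

  separatingPairs? : U.Decidable SeparatingPairs
  separatingPairs? ps =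
    All.all? (λ (v , u) → ¬? (u ≟ v)) ps ×-dec allPairs? disjoint? (map (uncurry separators) ps)

  separatingPairs⇒≤∣code∣ : ∀ {ps} → SeparatingPairs ps → ∀ {S} → IsSIDCode G S → length ps ≤ ∣ S ∣
  separatingPairs⇒≤∣code∣ {ps} (distinct , disjoint) code =
    subst (_≤ _) (length-map (uncurry separators) ps)
      (disjoint-hitting-≤ disjoint (map⁺ (All.map (separators-meet-code code) distinct)))

  isSIDNumber-by-computation : (S : Subset N) (ps : List (Fin N × Fin N)) →
                               True (isSIDCode? S) → True (separatingPairs? ps) →
                               length ps ≡ ∣ S ∣ → IsSIDNumber G (length ps)
  isSIDNumber-by-computation S ps code separating size =
    (S , toWitness code , sym size) , λ _ → separatingPairs⇒≤∣code∣ (toWitness separating)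

adjPath? : Decidable AdjPath
adjPath? a b = (suc a ℕ.≟ b) ⊎-dec (suc b ℕ.≟ a)

KxP-adj? : ∀ m n → Decidable (Adj (KxP m n))
KxP-adj? m n x y =
  ¬? (proj₁ (remQuot {m} n x) ≟ proj₁ (remQuot {m} n y)) ×-dec
  adjPath? (toℕ (proj₂ (remQuot {m} n x))) (toℕ (proj₂ (remQuot {m} n y)))

module K₃×P (n : ℕ) where
  open DecidableGraph (KxP 3 n) (KxP-adj? 3 n) public

  ⟨_,_⟩ : Fin 3 → Fin n → Fin (3 * n)
  ⟨_,_⟩ = combine

  -- For |a - c| = 2, N[(v_i,a)] ∖ N[(v_i,c)] is (v_i,a) together with, unless a is an end of the
  -- path, the two other copies of the column beyond a.
  sameCopyPairs : Fin n → Fin n → List (Fin (3 * n) × Fin (3 * n))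
  sameCopyPairs a c = map (λ i → ⟨ i , a ⟩ , ⟨ i , c ⟩) (allFin 3)

  -- For an end a of the path and its neighbour b, N[(v_{i+1},a)] ∖ N[(v_{i+2},b)] = {(v_i,b)}.
  crossCopyPairs : Fin n → Fin n → List (Fin (3 * n) × Fin (3 * n))
  crossCopyPairs a b =
    (⟨ # 1 , a ⟩ , ⟨ # 2 , b ⟩) ∷ (⟨ # 2 , a ⟩ , ⟨ # 0 , b ⟩) ∷ (⟨ # 0 , a ⟩ , ⟨ # 1 , b ⟩) ∷ []

  endPairs : Fin n → Fin n → Fin n → List (Fin (3 * n) × Fin (3 * n))
  endPairs a b c = sameCopyPairs a c ++ crossCopyPairs a b

γˢᴵᴰ-K₃×P₃ : IsSIDNumber (KxP 3 3) 9
γˢᴵᴰ-K₃×P₃ = isSIDNumber-by-computation ⊤ (endPairs (# 0) (# 1) (# 2) ++ sameCopyPairs (# 2) (# 0)) _ _ refl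
  where open K₃×P 3

γˢᴵᴰ-K₃×P₄ : IsSIDNumber (KxP 3 4) 12
γˢᴵᴰ-K₃×P₄ = isSIDNumber-by-computation ⊤ (endPairs (# 0) (# 1) (# 2) ++ endPairs (# 3) (# 2) (# 1)) _ _ refl
  where open K₃×P 4

γˢᴵᴰ-K₃×P₅ : IsSIDNumber (KxP 3 5) 12
γˢᴵᴰ-K₃×P₅ = isSIDNumber-by-computation (⊤ - ⟨ # 0 , # 2 ⟩ - ⟨ # 1 , # 2 ⟩ - ⟨ # 2 , # 2 ⟩)
       (endPairs (# 0) (# 1) (# 2) ++ endPairs (# 4) (# 3) (# 2)) _ _ refl
  where open K₃×P 5

γˢᴵᴰ-K₃×P₆ : IsSIDNumber (KxP 3 6) 14
γˢᴵᴰ-K₃×P₆ = isSIDNumber-by-computation (⊤ - ⟨ # 1 , # 2 ⟩ - ⟨ # 1 , # 3 ⟩ - ⟨ # 2 , # 2 ⟩ - ⟨ # 2 , # 3 ⟩)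
       (endPairs (# 0) (# 1) (# 2) ++ endPairs (# 5) (# 4) (# 3) ++
        (⟨ # 0 , # 2 ⟩ , ⟨ # 0 , # 0 ⟩) ∷ (⟨ # 0 , # 3 ⟩ , ⟨ # 0 , # 5 ⟩) ∷ []) _ _ refl
  where open K₃×P 6

theoremA1 : IsSIDNumber (KxP 3 3) 9 × IsSIDNumber (KxP 3 4) 12
    × IsSIDNumber (KxP 3 5) 12 × IsSIDNumber (KxP 3 6) 14
theoremA1 = γˢᴵᴰ-K₃×P₃ , γˢᴵᴰ-K₃×P₄ , γˢᴵᴰ-K₃×P₅ , γˢᴵᴰ-K₃×P₆
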